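{- Let $S$ be a forwarding network and $a,b,c$ agents with $\mathcal{N}_S(a,b,c)$. Then for every formula $A$, $\vdash\mathcal{J}_{a\leftarrow c}A\Rightarrow\mathcal{J}_{a\leftarrow b}\mathcal{J}_{b\leftarrow c}A$.
   Context: Setting: finite set of agents $\mathbb{A}$ with preorder $\sqsubseteq$; modalities $\mathcal{B}_a$, $\mathcal{I}_{a\leftarrow b}$ and $\Box$; formulas $A,B::=\top\mid\bot\mid t\mid\mathcal{M}A\mid A\Rightarrow B\mid A\wedge B\mid A\vee B$ (finite conjunctions allowed, empty one $=\top$). $\vdash$ is provability in intuitionistic propositional logic with K and necessitation for every modality, plus schemes $\mathcal{B}_aA\Rightarrow\mathcal{B}_a\mathcal{B}_aA$, $\mathcal{I}_{a\leftarrow b}A\Rightarrow\mathcal{B}_a\mathcal{I}_{a\leftarrow b}A$, $\mathcal{I}_{a\leftarrow b}A\Rightarrow\mathcal{I}_{a\leftarrow b}\mathcal{B}_bA$, for $a\sqsubseteq b$: $\mathcal{B}_aA\Rightarrow\mathcal{B}_bA$, $\mathcal{I}_{a\leftarrow c}A\Rightarrow\mathcal{I}_{b\leftarrow c}A$, $\mathcal{I}_{c\leftarrow a}A\Rightarrow\mathcal{I}_{c\leftarrow b}A$; $\Box A\Rightarrow\mathcal{M}\Box A$; $\Box A\Rightarrow A$. Notation $\mathcal{I}_{x_1\leftarrow\cdots\leftarrow x_k}:=\mathcal{I}_{x_1\leftarrow x_2}\cdots\mathcal{I}_{x_{k-1}\leftarrow x_k}$. A forwarding network is a set $S\subseteq\mathbb{A}^*$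 of non-empty lists of pairwise distinct agents such that (1) $(a,\beta,c)\in S$ implies $(\beta,c)\in S$ and $(a,\beta)\in S$; (2) $(\alpha,a,\beta,b,\gamma)\in S$ and $(a,\beta',b)\in S$ imply $(\alpha,a,\beta',b,\gamma)\in S$ (lists possibly empty, commas denote concatenation). $\mathcal{N}_S(a,b,c)$ means $(a,\alpha,b,\beta,c)\in S$ for some lists $\alpha,\beta$. $\mathcal{J}_{a\leftarrow b}A:=\bigwedge\{\mathcal{I}_{a\leftarrow\gamma\leftarrow b}A\mid(a,\gamma,b)\in S\}$. -}

module Defs where

open import Data.List using (List; []; _∷_; _++_; [_]; map; mapMaybe; foldr)
open import Data.List.Membership.Propositional using (_∈_)
open import Data.List.Relation.Unary.Unique.Propositional using (Unique)
open import Data.List.Relation.Unary.Any using (Any)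
open import Data.Maybe using (Maybe; just; nothing)
import Data.Maybe as Maybe
open import Data.Product using (∃; ∃-syntax; _×_)
open import Relation.Binary.Core using (Rel)
open import Relation.Binary.Definitions using (DecidableEquality)
open import Relation.Binary.Structures using (IsPreorder)
open import Relation.Binary.PropositionalEquality using (_≡_)
open import Relation.Nullary using (yes; no)

-- A finite set of agents with a preorder ⊑ (and decidable equality,
-- automatic for a finite set, needed to compute the conjunctions 𝒥).

record Agents : Set₁ where
  field
    Carrier   : Set
    _≟_       : DecidableEquality Carrier
    _⊑_       : Rel Carrier _
    isPreorder : IsPreorder _≡_ _⊑_
    enum      : List Carrier
    complete  : ∀ x → x ∈ enum

module Logic (Ag : Agents) (Atom : Set) where
  open Agents Ag renaming (Carrier to Agent)

  data Modality : Set where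
    𝓑  : Agent → Modality
    𝓘  : Agent → Agent → Modality    -- 𝓘 a b  is  𝓘_{a←b}
    □  : Modality

  infixr 5 _⇒_
  infixr 6 _∨_
  infixr 7 _∧_
  infixr 9 ⟨_⟩_
  data Formula : Set where
    ⊤′ ⊥′ : Formula
    atom  : Atom → Formula
    ⟨_⟩_  : Modality → Formula → Formula
    _⇒_ _∧_ _∨_ : Formula → Formula → Formula

  ⋀ : List Formula → Formula
  ⋀ = foldr _∧_ ⊤′

  infix 2 ⊢_
  data ⊢_ : Formula → Set where
    ax-k   : ∀ {A B} → ⊢ A ⇒ B ⇒ A
    ax-s   : ∀ {A B C} → ⊢ (A ⇒ B ⇒ C) ⇒ (A ⇒ B) ⇒ A ⇒ C
    ax-∧i  : ∀ {A B} → ⊢ A ⇒ B ⇒ A ∧ B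
    ax-∧e₁ : ∀ {A B} → ⊢ A ∧ B ⇒ A
    ax-∧e₂ : ∀ {A B} → ⊢ A ∧ B ⇒ B
    ax-∨i₁ : ∀ {A B} → ⊢ A ⇒ A ∨ B
    ax-∨i₂ : ∀ {A B} → ⊢ B ⇒ A ∨ B
    ax-∨e  : ∀ {A B C} → ⊢ (A ⇒ C) ⇒ (B ⇒ C) ⇒ A ∨ B ⇒ C
    ax-⊥e  : ∀ {A} → ⊢ ⊥′ ⇒ A
    ax-⊤i  : ⊢ ⊤′
    mp     : ∀ {A B} → ⊢ A ⇒ B → ⊢ A → ⊢ B
    ax-K   : ∀ {M A B} → ⊢ ⟨ M ⟩ (A ⇒ B) ⇒ ⟨ M ⟩ A ⇒ ⟨ M ⟩ B
    nec    : ∀ {M A} → ⊢ A → ⊢ ⟨ M ⟩ A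
    ax-𝓑𝓑   : ∀ {a A} → ⊢ ⟨ 𝓑 a ⟩ A ⇒ ⟨ 𝓑 a ⟩ ⟨ 𝓑 a ⟩ A
    ax-𝓘𝓑   : ∀ {a b A} → ⊢ ⟨ 𝓘 a b ⟩ A ⇒ ⟨ 𝓑 a ⟩ ⟨ 𝓘 a b ⟩ A
    ax-𝓘𝓑′  : ∀ {a b A} → ⊢ ⟨ 𝓘 a b ⟩ A ⇒ ⟨ 𝓘 a b ⟩ ⟨ 𝓑 b ⟩ A
    ax-⊑𝓑   : ∀ {a b A} → a ⊑ b → ⊢ ⟨ 𝓑 a ⟩ A ⇒ ⟨ 𝓑 b ⟩ A
    ax-⊑𝓘ˡ  : ∀ {a b c A} → a ⊑ b → ⊢ ⟨ 𝓘 a c ⟩ A ⇒ ⟨ 𝓘 b c ⟩ A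
    ax-⊑𝓘ʳ  : ∀ {a b c A} → a ⊑ b → ⊢ ⟨ 𝓘 c a ⟩ A ⇒ ⟨ 𝓘 c b ⟩ A
    ax-□M   : ∀ {M A} → ⊢ ⟨ □ ⟩ A ⇒ ⟨ M ⟩ ⟨ □ ⟩ A
    ax-□T   : ∀ {A} → ⊢ ⟨ □ ⟩ A ⇒ A

  𝓘-chain : List Agent → Formula → Formula
  𝓘-chain (x ∷ y ∷ rest) A = ⟨ 𝓘 x y ⟩ 𝓘-chain (y ∷ rest) A
  𝓘-chain _              A = A

  -- Forwarding networks (S a finite set of lists, given as a list;
  -- set membership = list membership ∈).

  record ForwardingNetwork (S : List (List Agent)) : Set where
    field
      nonEmpty : ∀ {ℓ} → ℓ ∈ S → ∃[ x ] ∃[ ℓ′ ] ℓ ≡ x ∷ ℓ′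
      distinct : ∀ {ℓ} → ℓ ∈ S → Unique ℓ
      closed₁  : ∀ a β c → (a ∷ β ++ [ c ]) ∈ S →
                 (β ++ [ c ]) ∈ S × (a ∷ β) ∈ S
      closed₂  : ∀ α a β b γ β′ → (α ++ a ∷ β ++ b ∷ γ) ∈ S →
                 (a ∷ β′ ++ [ b ]) ∈ S → (α ++ a ∷ β′ ++ b ∷ γ) ∈ S

  𝓝 : List (List Agent) → Agent → Agent → Agent → Set
  𝓝 S a b c = ∃[ α ] ∃[ β ] (a ∷ α ++ b ∷ β ++ [ c ]) ∈ S

  -- 𝓙_{a←b} A := ⋀ { 𝓘_{a←γ←b} A | (a,γ,b) ∈ S }

  initBefore : Agent → List Agent → Maybe (List Agent)
  initBefore b []          = nothing
  initBefore b (y ∷ [])    with y ≟ b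
  ... | yes _ = just []
  ... | no  _ = nothing
  initBefore b (y ∷ z ∷ r) = Maybe.map (y ∷_) (initBefore b (z ∷ r))

  inner : Agent → Agent → List Agent → Maybe (List Agent)
  inner a b []      = nothing
  inner a b (x ∷ r) with x ≟ a
  ... | yes _ = initBefore b r
  ... | no  _ = nothing

  𝓙 : List (List Agent) → Agent → Agent → Formula → Formula
  𝓙 S a b A = ⋀ (map (λ γ → 𝓘-chain (a ∷ γ ++ [ b ]) A) (mapMaybe (inner a b) S))

module Submission where

-- Every (a,γ,b) ∈ S can be spliced into a list (a,α,b,β,c) ∈ S witnessing 𝓝_S(a,b,c), and
-- then every (b,δ,c) ∈ S into the result, so (a,γ,b,δ,c) ∈ S by closure condition (2).
-- Hence each conjunct 𝓘_{a←γ←b} 𝓘_{b←δ←c} A = 𝓘_{a←γ←b←δ←c} A of 𝓙_{a←b} 𝓙_{b←c} A (after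
-- distributing the normal modalities 𝓘 over the conjunction 𝓙_{b←c}) is a conjunct of 𝓙_{a←c} A.

open import Defs
open import Data.Empty using (⊥-elim)
open import Data.List using (List; []; _∷_; _++_; [_]; mapMaybe)
open import Data.List.Properties using (++-assoc)
open import Data.List.Membership.Propositional using (_∈_)
open import Data.List.Membership.Propositional.Properties using (∈-map⁺)
open import Data.List.Relation.Unary.All as All using (All; []; _∷_)
import Data.List.Relation.Unary.All.Properties as All
open import Data.List.Relation.Unary.Any using (here; there)
import Data.List.Relation.Unary.Any as Any
import Data.List.Relation.Unary.Any.Properties as Any
open import Data.Maybe using (just; nothing)
import Data.Maybe.Relation.Unary.All as MaybeAll
import Data.Maybe.Relation.Unary.Any as MaybeAny
open import Data.Product using (_,_)
open import Relation.Binary.PropositionalEquality using (_≡_; refl; sym; cong; subst; module ≡-Reasoning)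
open import Relation.Nullary using (yes; no)

module _ (Ag : Agents) (Atom : Set) where
  open Agents Ag renaming (Carrier to Agent)
  open Logic Ag Atom

  ⊢-weaken : ∀ {H X} → ⊢ X → ⊢ H ⇒ X
  ⊢-weaken = mp ax-k

  ⊢-trans : ∀ {X Y Z} → ⊢ X ⇒ Y → ⊢ Y ⇒ Z → ⊢ X ⇒ Z
  ⊢-trans f g = mp (mp ax-s (⊢-weaken g)) f

  ⊢-lift₂ : ∀ {H X Y Z} → ⊢ X ⇒ Y ⇒ Z → ⊢ H ⇒ X → ⊢ H ⇒ Y → ⊢ H ⇒ Z
  ⊢-lift₂ r f g = mp (mp ax-s (mp (mp ax-s (⊢-weaken r)) f)) g

  ⟨⟩-mono₂ : ∀ {M X Y Z} → ⊢ X ⇒ Y ⇒ Z → ⊢ ⟨ M ⟩ X ⇒ ⟨ M ⟩ Y ⇒ ⟨ M ⟩ Z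
  ⟨⟩-mono₂ r = ⊢-trans (mp ax-K (nec r)) ax-K

  𝓘-chain-nec : ∀ l {X} → ⊢ X → ⊢ 𝓘-chain l X
  𝓘-chain-nec []          p = p
  𝓘-chain-nec (x ∷ [])    p = p
  𝓘-chain-nec (x ∷ y ∷ l) p = nec (𝓘-chain-nec (y ∷ l) p)

  𝓘-chain-mono₂ : ∀ l {X Y Z} → ⊢ X ⇒ Y ⇒ Z →
                  ⊢ 𝓘-chain l X ⇒ 𝓘-chain l Y ⇒ 𝓘-chain l Z
  𝓘-chain-mono₂ []          r = r
  𝓘-chain-mono₂ (x ∷ [])    r = r
  𝓘-chain-mono₂ (x ∷ y ∷ l) r = ⟨⟩-mono₂ (𝓘-chain-mono₂ (y ∷ l) r)

  𝓘-chain-++ : ∀ l b m {A} →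
               𝓘-chain (l ++ [ b ]) (𝓘-chain (b ∷ m) A) ≡ 𝓘-chain (l ++ b ∷ m) A
  𝓘-chain-++ []          b m = refl
  𝓘-chain-++ (x ∷ [])    b m = refl
  𝓘-chain-++ (x ∷ y ∷ l) b m = cong (⟨ 𝓘 x y ⟩_) (𝓘-chain-++ (y ∷ l) b m)

  𝓘-chain-join : ∀ a γ b δ c {A} →
                 𝓘-chain (a ∷ γ ++ [ b ]) (𝓘-chain (b ∷ δ ++ [ c ]) A) ≡
                 𝓘-chain (a ∷ (γ ++ b ∷ δ) ++ [ c ]) A
  𝓘-chain-join a γ b δ c {A} = begin
    𝓘-chain (a ∷ γ ++ [ b ]) (𝓘-chain (b ∷ δ ++ [ c ]) A) ≡⟨ 𝓘-chain-++ (a ∷ γ) b (δ ++ [ c ]) ⟩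
    𝓘-chain (a ∷ γ ++ b ∷ δ ++ [ c ]) A                   ≡⟨ cong (λ l → 𝓘-chain (a ∷ l) A) (++-assoc γ (b ∷ δ) [ c ]) ⟨
    𝓘-chain (a ∷ (γ ++ b ∷ δ) ++ [ c ]) A                 ∎
    where open ≡-Reasoning

  ⋀-elim : ∀ {X L} → X ∈ L → ⊢ ⋀ L ⇒ X
  ⋀-elim (here refl) = ax-∧e₁
  ⋀-elim (there p)   = ⊢-trans ax-∧e₂ (⋀-elim p)

  𝓘-chain-⋀-intro : ∀ {H} l {L} → All (λ X → ⊢ H ⇒ 𝓘-chain l X) L → ⊢ H ⇒ 𝓘-chain l (⋀ L)
  𝓘-chain-⋀-intro l []       = ⊢-weaken (𝓘-chain-nec l ax-⊤i)
  𝓘-chain-⋀-intro l (p ∷ ps) = ⊢-lift₂ (𝓘-chain-mono₂ l ax-∧i) p (𝓘-chain-⋀-intro l ps)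

  initBefore-complete : ∀ b γ → initBefore b (γ ++ [ b ]) ≡ just γ
  initBefore-complete b [] with b ≟ b
  ... | yes _ = refl
  ... | no b≢b = ⊥-elim (b≢b refl)
  initBefore-complete b (x ∷ [])    rewrite initBefore-complete b []      = refl
  initBefore-complete b (x ∷ y ∷ γ) rewrite initBefore-complete b (y ∷ γ) = refl

  initBefore-sound : ∀ b r {γ} → initBefore b r ≡ just γ → r ≡ γ ++ [ b ]
  initBefore-sound b (y ∷ []) e with y ≟ b
  initBefore-sound b (y ∷ []) refl | yes refl = refl
  initBefore-sound b (y ∷ z ∷ r) e with initBefore b (z ∷ r) in eq
  initBefore-sound b (y ∷ z ∷ r) refl | just γ = cong (y ∷_) (initBefore-sound b (z ∷ r) eq)

  inner-complete : ∀ a b γ → inner a b (a ∷ γ ++ [ b ]) ≡ just γ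
  inner-complete a b γ with a ≟ a
  ... | yes _ = initBefore-complete b γ
  ... | no a≢a = ⊥-elim (a≢a refl)

  inner-sound : ∀ a b ℓ {γ} → inner a b ℓ ≡ just γ → ℓ ≡ a ∷ γ ++ [ b ]
  inner-sound a b (x ∷ r) e with x ≟ a
  inner-sound a b (x ∷ r) e | yes refl = cong (x ∷_) (initBefore-sound b r e)

  inner-All : ∀ {P : List Agent → Set} a b ℓ →
              (∀ {γ} → ℓ ≡ a ∷ γ ++ [ b ] → P γ) → MaybeAll.All P (inner a b ℓ)
  inner-All a b ℓ k with inner a b ℓ in eq
  ... | just γ  = MaybeAll.just (k (inner-sound a b ℓ eq))
  ... | nothing = MaybeAll.nothing

  ∈-mapMaybe-inner⁺ : ∀ {S a b γ} → (a ∷ γ ++ [ b ]) ∈ S → γ ∈ mapMaybe (inner a b) S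
  ∈-mapMaybe-inner⁺ {S} {a} {b} {γ} ℓ∈ =
    Any.mapMaybe⁺ (inner a b) S (Any.map⁺ (Any.map justγ ℓ∈))
    where
    justγ : ∀ {ℓ} → a ∷ γ ++ [ b ] ≡ ℓ → MaybeAny.Any (γ ≡_) (inner a b ℓ)
    justγ refl = subst (MaybeAny.Any (γ ≡_)) (sym (inner-complete a b γ)) (MaybeAny.just refl)

  𝓙-elim : ∀ {S a b γ A} → (a ∷ γ ++ [ b ]) ∈ S → ⊢ 𝓙 S a b A ⇒ 𝓘-chain (a ∷ γ ++ [ b ]) A
  𝓙-elim ℓ∈ = ⋀-elim (∈-map⁺ _ (∈-mapMaybe-inner⁺ ℓ∈))

  𝓘-chain-𝓙-intro : ∀ {H} l S a b {A} →
                    (∀ {γ} → (a ∷ γ ++ [ b ]) ∈ S → ⊢ H ⇒ 𝓘-chain l (𝓘-chain (a ∷ γ ++ [ b ]) A)) →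
                    ⊢ H ⇒ 𝓘-chain l (𝓙 S a b A)
  𝓘-chain-𝓙-intro l S a b k =
    𝓘-chain-⋀-intro l (All.map⁺ (All.mapMaybe⁺ (All.map⁺ (All.tabulate λ {ℓ} ℓ∈ →
      inner-All a b ℓ λ { refl → k ℓ∈ }))))

  splice : ∀ {S} → ForwardingNetwork S → ∀ {a b c γ δ} → 𝓝 S a b c →
           (a ∷ γ ++ [ b ]) ∈ S → (b ∷ δ ++ [ c ]) ∈ S → (a ∷ (γ ++ b ∷ δ) ++ [ c ]) ∈ S
  splice {S} FN {a} {b} {c} {γ} {δ} (α , β , abc∈) γ∈ δ∈ =
    subst (λ l → (a ∷ l) ∈ S) (sym (++-assoc γ (b ∷ δ) [ c ])) aγbδc∈
    where
    open ForwardingNetwork FN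
    aγbβc∈ : (a ∷ γ ++ b ∷ β ++ [ c ]) ∈ S
    aγbβc∈ = closed₂ [] a α b (β ++ [ c ]) γ abc∈ γ∈
    aγbδc∈ : (a ∷ γ ++ b ∷ δ ++ [ c ]) ∈ S
    aγbδc∈ = closed₂ (a ∷ γ) b β c [] δ aγbβc∈ δ∈

lemma7 : (Ag : Agents) (Atom : Set) →
    let open Agents Ag using (Carrier) in
    let open Logic Ag Atom in
    (S : List (List Carrier)) → ForwardingNetwork S →
    (a b c : Carrier) → 𝓝 S a b c →
    (A : Formula) →
    ⊢ 𝓙 S a c A ⇒ 𝓙 S a b (𝓙 S b c A)
lemma7 Ag Atom S FN a b c abc A =
  𝓘-chain-𝓙-intro Ag Atom [] S a b λ {γ} γ∈ →
  𝓘-chain-𝓙-intro Ag Atom (a ∷ γ ++ [ b ]) S b c λ {δ} δ∈ →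
  subst (λ X → ⊢ 𝓙 S a c A ⇒ X) (sym (𝓘-chain-join Ag Atom a γ b δ c))
        (𝓙-elim Ag Atom (splice Ag Atom FN abc γ∈ δ∈))
  where open Logic Ag Atom
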